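{- Let $\Gamma$ be a conservative valued constraint language on a finite domain $D$ such that $G_\Gamma$ has no soft self-loop. Then for every vertex $v$ of $G_\Gamma$, $G_\Gamma$ contains the edge $v-\overline{v}$. Moreover, there is no edge between $M$ and $\overline{M}$, there is no odd cycle in $G_\Gamma$ on vertices of $M$, and there is no soft edge between vertices of $\overline{M}$.
   Context: A weighted relation of arity $r$ on $D$ is a map $D^r\to\mathbb{Q}\cup\{\infty\}$; a relation has values in $\{0,\infty\}$. $\mathrm{Feas}(\gamma)=\{\mathbf{x}:\gamma(\mathbf{x})<\infty\}$, $\mathrm{Opt}(\gamma)$ is the relation of tuples in $\mathrm{Feas}(\gamma)$ of minimum value. $\Gamma$ is conservative if it contains all unary weighted relations $D\to\{0,1\}$. $\mathcal{C}(\Gamma)$ is the smallest set of weighted relations on $D$ containing $\Gamma$, all unary weighted relations on $D$ and the binary equality relation on $D$, and closed under: $\mathrm{Feas}$ and $\mathrm{Opt}$; adding a unary weighted relation $\mu$ at a coordinate $i$ ($\gamma'(\mathbf{x})=\gamma(\mathbf{x})+\mu(x_i)$); minimisation at a coordinate ($\gamma'(x_1,..,x_{i-1},x_{i+1},..,x_r)=\min_{x_i\in D}\gamma(\mathbf{x})$); and join of binary $\gamma_1,\gamma_2$: $\gamma(x,y)=\min_{z\in D}(\gamma_1(u_1,v_1)+\gamma_2(u_2,v_2))$ with $\{u_1,v_1\}=\{x,z\}$, $\{u_2,v_2\}=\{y,z\}$ (either order). $G_\Gamma$ is the undirected graph (self-loops allowed) on vertices $(a,b)\in D^2$, $a\ne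 b$, with an edge $(a_1,b_1)-(a_2,b_2)$ iff there is a binary $\gamma\in\mathcal{C}(\Gamma)$ with $(a_1,b_2),(b_1,a_2)\in\mathrm{Feas}(\gamma)$ and $\gamma(a_1,b_2)+\gamma(b_1,a_2)<\gamma(a_1,a_2)+\gamma(b_1,b_2)$; the edge is soft if some such $\gamma$ also has at least one of $(a_1,a_2),(b_1,b_2)$ in $\mathrm{Feas}(\gamma)$. For a vertex $v=(a,b)$, $\overline{v}=(b,a)$. $\overline{M}$ is the set of vertices with a self-loop, $M$ the set of those without. -}

module Defs where

open import Data.Nat using (ℕ; zero; suc; _+_; _*_; _≤_)
open import Data.Fin using (Fin; zero; suc; inject₁; fromℕ)
open import Data.Bool using (Bool; true; false; if_then_else_)
open import Data.Product using (Σ; ∃; _×_; _,_)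
open import Data.Sum using (_⊎_)
open import Data.List using (foldr; map)
open import Data.Fin.Properties using () renaming (_≟_ to _≟ᶠ_)
open import Data.List using (List)
open import Data.Vec.Functional using (Vector; _∷_; insertAt)
open import Data.Rational using (ℚ; 0ℚ; 1ℚ) renaming (_+_ to _+ℚ_; _<_ to _<ℚ_; _⊓_ to _⊓ℚ_)
open import Data.Rational.Properties using () renaming (_≟_ to _≟ℚ_)
open import Data.Unit using (⊤)
open import Data.Empty using (⊥)
open import Relation.Nullary using (¬_; yes; no)
open import Relation.Nullary.Decidable using (⌊_⌋)
open import Relation.Binary.PropositionalEquality using (_≡_; _≢_; refl)
import Data.List as L

data ℚ∞ : Set where
  fin : ℚ → ℚ∞
  ∞   : ℚ∞

_+∞_ : ℚ∞ → ℚ∞ → ℚ∞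
fin p +∞ fin q = fin (p +ℚ q)
fin _ +∞ ∞     = ∞
∞     +∞ _     = ∞

_⊓∞_ : ℚ∞ → ℚ∞ → ℚ∞
fin p ⊓∞ fin q = fin (p ⊓ℚ q)
fin p ⊓∞ ∞     = fin p
∞     ⊓∞ y     = y

_<∞_ : ℚ∞ → ℚ∞ → Set
fin p <∞ fin q = p <ℚ q
fin _ <∞ ∞     = ⊤
∞     <∞ _     = ⊥

IsFinite : ℚ∞ → Set
IsFinite (fin _) = ⊤
IsFinite ∞       = ⊥

_=∞?_ : ℚ∞ → ℚ∞ → Bool
fin p =∞? fin q = ⌊ p ≟ℚ q ⌋
fin _ =∞? ∞     = false
∞     =∞? fin _ = false
∞     =∞? ∞     = true

Dom : ℕ → Set
Dom n = Fin n

WRel : ℕ → ℕ → Set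
WRel n r = Vector (Fin n) r → ℚ∞

-- minimum of a function over the (finite) domain; min of ∅ is ∞
minOver : ∀ {n} → (Fin n → ℚ∞) → ℚ∞
minOver {n} f = foldr _⊓∞_ ∞ (map f (L.allFin n))

minAll : ∀ {n} r → (Vector (Fin n) r → ℚ∞) → ℚ∞
minAll zero    f = f (λ ())
minAll (suc r) f = minOver (λ d → minAll r (λ xs → f (d ∷ xs)))

Feas : ∀ {n r} → WRel n r → WRel n r
Feas γ x with γ x
... | fin _ = fin 0ℚ
... | ∞     = ∞

Opt : ∀ {n r} → WRel n r → WRel n r
Opt {r = r} γ x with γ x
... | ∞     = ∞
... | fin q = if fin q =∞? minAll r γ then fin 0ℚ else ∞

addUnary : ∀ {n r} → WRel n r → Fin r → (Fin n → ℚ∞) → WRel n r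
addUnary γ i μ x = γ x +∞ μ (x i)

minimise : ∀ {n r} → WRel n (suc r) → Fin (suc r) → WRel n r
minimise γ i x = minOver (λ d → γ (insertAt x i d))

pair : ∀ {n} → Fin n → Fin n → Vector (Fin n) 2
pair a b = a ∷ (b ∷ (λ ()))

orient : ∀ {n} → Bool → Fin n → Fin n → Vector (Fin n) 2
orient false x z = pair x z
orient true  x z = pair z x

join : ∀ {n} → Bool → Bool → WRel n 2 → WRel n 2 → WRel n 2
join s₁ s₂ γ₁ γ₂ xy =
  minOver (λ z → γ₁ (orient s₁ (xy zero) z) +∞ γ₂ (orient s₂ (xy (suc zero)) z))

unaryRel : ∀ {n} → (Fin n → ℚ∞) → WRel n 1
unaryRel μ x = μ (x zero)

eqRel : ∀ {n} → WRel n 2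
eqRel x = if ⌊ x zero ≟ᶠ x (suc zero) ⌋ then fin 0ℚ else ∞

Language : ℕ → Set₁
Language n = (r : ℕ) → WRel n r → Set

Conservative : ∀ {n} → Language n → Set
Conservative {n} Γ = (μ : Fin n → Bool) →
  Σ (WRel n 1) λ γ → Γ 1 γ × ((x : Vector (Fin n) 1) →
     γ x ≡ fin (if μ (x zero) then 1ℚ else 0ℚ))

-- The closure 𝒞(Γ) (sets of functions are taken extensionally: `ext`)
data 𝒞 {n} (Γ : Language n) : (r : ℕ) → WRel n r → Set where
  base     : ∀ {r γ} → Γ r γ → 𝒞 Γ r γ
  unary    : (μ : Fin n → ℚ∞) → 𝒞 Γ 1 (unaryRel μ)
  equality : 𝒞 Γ 2 eqRel
  feas     : ∀ {r γ} → 𝒞 Γ r γ → 𝒞 Γ r (Feas γ)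
  opt      : ∀ {r γ} → 𝒞 Γ r γ → 𝒞 Γ r (Opt γ)
  add      : ∀ {r γ} → 𝒞 Γ r γ → (i : Fin r) (μ : Fin n → ℚ∞) → 𝒞 Γ r (addUnary γ i μ)
  min      : ∀ {r γ} → 𝒞 Γ (suc r) γ → (i : Fin (suc r)) → 𝒞 Γ r (minimise γ i)
  joinC    : ∀ {γ₁ γ₂} → 𝒞 Γ 2 γ₁ → 𝒞 Γ 2 γ₂ → (s₁ s₂ : Bool) → 𝒞 Γ 2 (join s₁ s₂ γ₁ γ₂)
  ext      : ∀ {r γ γ'} → 𝒞 Γ r γ → ((x : Vector (Fin n) r) → γ x ≡ γ' x) → 𝒞 Γ r γ'

record Vertex (n : ℕ) : Set where
  constructor vtx
  field
    fst : Fin n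
    snd : Fin n
    distinct : fst ≢ snd
open Vertex public

flipV : ∀ {n} → Vertex n → Vertex n
flipV (vtx a b a≢b) = vtx b a (λ e → a≢b (Relation.Binary.PropositionalEquality.sym e))
  where import Relation.Binary.PropositionalEquality

EdgeWitness : ∀ {n} → WRel n 2 → Vertex n → Vertex n → Set
EdgeWitness γ (vtx a₁ b₁ _) (vtx a₂ b₂ _) =
  IsFinite (γ (pair a₁ b₂)) × IsFinite (γ (pair b₁ a₂)) ×
  ((γ (pair a₁ b₂) +∞ γ (pair b₁ a₂)) <∞ (γ (pair a₁ a₂) +∞ γ (pair b₁ b₂)))

SoftExtra : ∀ {n} → WRel n 2 → Vertex n → Vertex n → Set
SoftExtra γ (vtx a₁ b₁ _) (vtx a₂ b₂ _) =
  IsFinite (γ (pair a₁ a₂)) ⊎ IsFinite (γ (pair b₁ b₂))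

EdgeCond : ∀ {n} → Language n → Vertex n → Vertex n → Set
EdgeCond Γ v w = Σ (WRel _ 2) λ γ → 𝒞 Γ 2 γ × EdgeWitness γ v w

SoftCond : ∀ {n} → Language n → Vertex n → Vertex n → Set
SoftCond Γ v w = Σ (WRel _ 2) λ γ → 𝒞 Γ 2 γ × EdgeWitness γ v w × SoftExtra γ v w

Edge : ∀ {n} → Language n → Vertex n → Vertex n → Set
Edge Γ v w = EdgeCond Γ v w ⊎ EdgeCond Γ w v

SoftEdge : ∀ {n} → Language n → Vertex n → Vertex n → Set
SoftEdge Γ v w = SoftCond Γ v w ⊎ SoftCond Γ w v

InMbar : ∀ {n} → Language n → Vertex n → Set
InMbar Γ v = Edge Γ v v

InM : ∀ {n} → Language n → Vertex n → Set
InM Γ v = ¬ Edge Γ v v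

-- A cycle of length k = suc m ≥ 3 in G_Γ: pairwise distinct vertices
-- c 0, …, c m with edges c i - c (i+1) and c m - c 0.
record Cycle {n} (Γ : Language n) (m : ℕ) : Set where
  field
    c        : Fin (suc m) → Vertex n
    long     : 2 ≤ m
    distinct : ∀ i j → fst (c i) ≡ fst (c j) → snd (c i) ≡ snd (c j) → i ≡ j
    steps    : ∀ (i : Fin m) → Edge Γ (c (inject₁ i)) (c (suc i))
    closing  : Edge Γ (c (fromℕ m)) (c zero)

OddCycleInM : ∀ {n} → Language n → Set
OddCycleInM Γ = Σ ℕ λ m → Σ (Cycle Γ m) λ C →
  (Σ ℕ λ j → m ≡ 2 * j) × (∀ i → InM Γ (Cycle.c C i))

-- Call a binary relation P on D realisable if P = Feas β for some binary β ∈ 𝒞(Γ). Realisable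
-- relations are closed under relational composition (join) and converse (join with equality).
-- An edge (a₁,b₁) – (a₂,b₂) witnessed by γ makes the crossing {(a₁,b₂), (b₁,a₂)} realisable:
-- unary weights confine γ to {a₁,b₁} × {a₂,b₂} and shift it so that its minimum m is attained
-- exactly on that antidiagonal, and Opt keeps the minimisers; the edge inequality q + r < p + s
-- is precisely what leaves room for m. Conversely every realisable crossing is an edge. Composing
-- crossings along walks gives the graph statements: equality yields v – v̄, an edge from v to a
-- loop at w and back yields a loop at v, and so does an odd closed walk from v. For a soft edge
-- into a loop at w, taking m = q + r − s keeps the corner (b₁,b₂) as well; composing that
-- three-point relation with the loop at w and back produces a soft loop at v. Only this last step
-- uses that G_Γ has no soft self-loop.
module Submission where

open import Defs
open import Data.Bool.Base using (Bool; true; false)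
open import Data.Empty using (⊥; ⊥-elim)
open import Data.Fin.Base using (Fin; zero; suc; inject₁; fromℕ)
open import Data.Fin.Properties using (_≟_)
import Data.List.Base as List
open import Data.List.Membership.Propositional using (_∈_)
open import Data.List.Membership.Propositional.Properties using (∈-allFin)
open import Data.List.Relation.Unary.Any using (here; there)
open import Data.Nat.Base using (ℕ; zero; suc; parity)
open import Data.Parity.Base using (Parity; 0ℙ; 1ℙ; _⁻¹)
open import Data.Parity.Properties using (⁻¹-selfInverse; suc-homo-⁻¹; *-homo-*)
open import Data.Product using (Σ; ∃-syntax; _×_; _,_; proj₁; proj₂) renaming (swap to ×-swap)
open import Data.Rational.Base using (ℚ; 0ℚ; 1ℚ; _+_; _-_; -_; _≤_; _<_)
import Data.Rational.Properties as ℚ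
open import Data.Rational.Solver using (module +-*-Solver)
open import Data.Sum.Base using (_⊎_; inj₁; inj₂; swap; [_,_]′) renaming (map to ⊎-map)
open import Data.Unit using (⊤; tt)
open import Function.Base using (flip; id)
open import Level using (0ℓ)
open import Relation.Binary.Core using (Rel; _⇒_; _⇔_)
open import Relation.Binary.Construct.Composition using (_;_)
open import Relation.Binary.Construct.Union using (_∪_)
open import Relation.Binary.PropositionalEquality
  using (_≡_; _≢_; refl; sym; trans; cong; cong₂; subst; subst₂; module ≡-Reasoning)
open import Relation.Nullary using (¬_; yes; no; contradiction)

open +-*-Solver using (solve; _:+_; _:-_; _:=_)

[p+q]-q≡p : ∀ p q → (p + q) - q ≡ p
[p+q]-q≡p = solve 2 (λ p q → (p :+ q) :- q := p) refl

p+[q-p]≡q : ∀ p q → p + (q - p) ≡ q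
p+[q-p]≡q = solve 2 (λ p q → p :+ (q :- p) := q) refl

p<p+1 : ∀ p → p < p + 1ℚ
p<p+1 p = subst (_< p + 1ℚ) (ℚ.+-identityʳ p) (ℚ.+-monoʳ-< p (ℚ.positive⁻¹ 1ℚ))

p-1<p : ∀ p → p - 1ℚ < p
p-1<p p = subst (p - 1ℚ <_) ([p+q]-q≡p p (- 1ℚ)) (p<p+1 (p - 1ℚ))

p-q<r⇒p<q+r : ∀ {p q r} → p - q < r → p < q + r
p-q<r⇒p<q+r {p} {q} {r} p-q<r = subst (_< q + r) (p+[q-p]≡q q p) (ℚ.+-monoʳ-< q p-q<r)

p<r+q⇒p-q<r : ∀ {p q} r → p < r + q → p - q < r
p<r+q⇒p-q<r {p} {q} r p<r+q = subst (p - q <_) ([p+q]-q≡p r q) (ℚ.+-monoˡ-< (- q) p<r+q)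

infix 4 _≤∞_

_≤∞_ : ℚ∞ → ℚ∞ → Set
fin p ≤∞ fin q = p ≤ q
_     ≤∞ ∞     = ⊤
∞     ≤∞ fin _ = ⊥

≤∞-trans : ∀ {x y z} → x ≤∞ y → y ≤∞ z → x ≤∞ z
≤∞-trans {fin _} {fin _} {fin _} x≤y y≤z = ℚ.≤-trans x≤y y≤z
≤∞-trans {fin _} {_}     {∞}     _   _   = tt
≤∞-trans {∞}     {_}     {∞}     _   _   = tt
≤∞-trans {fin _} {∞}     {fin _} _   ()
≤∞-trans {∞}     {fin _} {fin _} ()  _
≤∞-trans {∞}     {∞}     {fin _} _   ()

≤∞-antisym : ∀ {x y} → x ≤∞ y → y ≤∞ x → x ≡ y
≤∞-antisym {fin _} {fin _} x≤y y≤x = cong fin (ℚ.≤-antisym x≤y y≤x)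
≤∞-antisym {∞}     {∞}     _   _   = refl
≤∞-antisym {fin _} {∞}     _   ()
≤∞-antisym {∞}     {fin _} ()  _

x⊓∞y≤∞x : ∀ x y → x ⊓∞ y ≤∞ x
x⊓∞y≤∞x (fin p) (fin q) = ℚ.p⊓q≤p p q
x⊓∞y≤∞x (fin _) ∞       = ℚ.≤-refl
x⊓∞y≤∞x ∞       (fin _) = tt
x⊓∞y≤∞x ∞       ∞       = tt

x⊓∞y≤∞y : ∀ x y → x ⊓∞ y ≤∞ y
x⊓∞y≤∞y (fin p) (fin q) = ℚ.p⊓q≤q p q
x⊓∞y≤∞y (fin _) ∞       = tt
x⊓∞y≤∞y ∞       (fin _) = ℚ.≤-refl
x⊓∞y≤∞y ∞       ∞       = tt

⊓∞-glb : ∀ {x y z} → x ≤∞ y → x ≤∞ z → x ≤∞ y ⊓∞ z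
⊓∞-glb {fin _} {fin _} {fin _} x≤y x≤z = ℚ.⊓-glb x≤y x≤z
⊓∞-glb {fin _} {fin _} {∞}     x≤y _   = x≤y
⊓∞-glb {fin _} {∞}     {_}     _   x≤z = x≤z
⊓∞-glb {∞}     {∞}     {∞}     _   _   = tt
⊓∞-glb {∞}     {fin _} {_}     ()  _
⊓∞-glb {∞}     {∞}     {fin _} _   ()

<∞⇒≤∞ : ∀ {x y} → x <∞ y → x ≤∞ y
<∞⇒≤∞ {fin _} {fin _} x<y = ℚ.<⇒≤ x<y
<∞⇒≤∞ {fin _} {∞}     _   = tt

<∞⇒≢ : ∀ {c x} → fin c <∞ x → x ≢ fin c
<∞⇒≢ {x = fin _} c<x refl = ℚ.<-irrefl refl c<x

≤∞-if-finite : ∀ {c x} → (IsFinite x → fin c ≤∞ x) → fin c ≤∞ x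
≤∞-if-finite {x = fin _} c≤x = c≤x tt
≤∞-if-finite {x = ∞}     _   = tt

≤∞fin⇒finite : ∀ {x q} → x ≤∞ fin q → IsFinite x
≤∞fin⇒finite {fin _} _ = tt

finite⇒≡fin : ∀ {x} → IsFinite x → ∃[ q ] x ≡ fin q
finite⇒≡fin {fin q} _ = q , refl

fin-injective : ∀ {p q} → fin p ≡ fin q → p ≡ q
fin-injective refl = refl

+∞-finite : ∀ {x y} → IsFinite x → IsFinite y → IsFinite (x +∞ y)
+∞-finite {fin _} {fin _} _ _ = tt

+∞-finite⁻ : ∀ {x y} → IsFinite (x +∞ y) → IsFinite x × IsFinite y
+∞-finite⁻ {fin _} {fin _} _ = tt , tt

+∞-identityʳ : ∀ x → x +∞ fin 0ℚ ≡ x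
+∞-identityʳ (fin p) = cong fin (ℚ.+-identityʳ p)
+∞-identityʳ ∞       = refl

+∞-comm : ∀ x y → x +∞ y ≡ y +∞ x
+∞-comm (fin p) (fin q) = cong fin (ℚ.+-comm p q)
+∞-comm (fin _) ∞       = refl
+∞-comm ∞       (fin _) = refl
+∞-comm ∞       ∞       = refl

+∞-monoˡ-≤ : ∀ d {x y} → x ≤∞ y → x +∞ fin d ≤∞ y +∞ fin d
+∞-monoˡ-≤ d {fin _} {fin _} x≤y = ℚ.+-monoˡ-≤ d x≤y
+∞-monoˡ-≤ d {fin _} {∞}     _   = tt
+∞-monoˡ-≤ d {∞}     {∞}     _   = tt

+∞-cancelʳ : ∀ d {x y} → x +∞ fin d ≡ y +∞ fin d → x ≡ y
+∞-cancelʳ d {fin p} {fin q} eq = cong fin (begin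
  p           ≡⟨ [p+q]-q≡p p d ⟨
  (p + d) - d ≡⟨ cong (_- d) (fin-injective eq) ⟩
  (q + d) - d ≡⟨ [p+q]-q≡p q d ⟩
  q           ∎)
  where open ≡-Reasoning
+∞-cancelʳ d {∞}     {∞}     _  = refl
+∞-cancelʳ d {fin _} {∞}     ()
+∞-cancelʳ d {∞}     {fin _} ()

p<∞x+q⇒p-q<∞x : ∀ {p q} x → fin p <∞ (x +∞ fin q) → fin (p - q) <∞ x
p<∞x+q⇒p-q<∞x (fin r) p<r+q = p<r+q⇒p-q<r r p<r+q
p<∞x+q⇒p-q<∞x ∞       _     = tt

between : ∀ {c} x y → fin c <∞ (x +∞ y) → ∃[ m ] fin c <∞ (y +∞ fin m) × fin m <∞ x
between     ∞       ∞       _     = 0ℚ , tt , tt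
between {c} ∞       (fin s) _     = c - s + 1ℚ , p-q<r⇒p<q+r (p<p+1 (c - s)) , tt
between     (fin p) ∞       _     = p - 1ℚ , tt , p-1<p p
between     (fin p) (fin s) c<p+s =
  let m , c-s<m , m<p = ℚ.<-dense (p<r+q⇒p-q<r p c<p+s) in m , p-q<r⇒p<q+r c-s<m , m<p

module _ {n} (f : Fin n → ℚ∞) where

  private
    ⨅ : List.List (Fin n) → ℚ∞
    ⨅ zs = List.foldr _⊓∞_ ∞ (List.map f zs)

    ⨅-≤ : ∀ {z zs} → z ∈ zs → ⨅ zs ≤∞ f z
    ⨅-≤ {zs = z List.∷ zs} (here refl)  = x⊓∞y≤∞x (f z) (⨅ zs)
    ⨅-≤ {zs = y List.∷ zs} (there z∈zs) = ≤∞-trans (x⊓∞y≤∞y (f y) (⨅ zs)) (⨅-≤ z∈zs)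

    ⨅-glb : ∀ {x} → (∀ z → x ≤∞ f z) → ∀ zs → x ≤∞ ⨅ zs
    ⨅-glb {fin _} _   List.[]       = tt
    ⨅-glb {∞}     _   List.[]       = tt
    ⨅-glb         x≤f (z List.∷ zs) = ⊓∞-glb (x≤f z) (⨅-glb x≤f zs)

    ⨅-finite⁻ : ∀ zs → IsFinite (⨅ zs) → ∃[ z ] IsFinite (f z)
    ⨅-finite⁻ List.[]       ()
    ⨅-finite⁻ (z List.∷ zs) h with f z in fz≡
    ... | fin _ = z , subst IsFinite (sym fz≡) tt
    ... | ∞     = ⨅-finite⁻ zs h

  minOver-≤ : ∀ z → minOver f ≤∞ f z
  minOver-≤ z = ⨅-≤ (∈-allFin z)

  minOver-glb : ∀ {x} → (∀ z → x ≤∞ f z) → x ≤∞ minOver f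
  minOver-glb x≤f = ⨅-glb x≤f (List.allFin n)

  minOver-finite⁻ : IsFinite (minOver f) → ∃[ z ] IsFinite (f z)
  minOver-finite⁻ = ⨅-finite⁻ (List.allFin n)

  minOver-finite : ∀ {z} → IsFinite (f z) → IsFinite (minOver f)
  minOver-finite {z} h with f z | minOver-≤ z
  ... | fin _ | min≤fz = ≤∞fin⇒finite min≤fz

  minOver-attained : ∀ {z m} → f z ≡ fin m → (∀ z → fin m ≤∞ f z) → minOver f ≡ fin m
  minOver-attained {z} fz≡m m≤f =
    ≤∞-antisym (subst (minOver f ≤∞_) fz≡m (minOver-≤ z)) (minOver-glb m≤f)

minAll₂-attained : ∀ {n} (δ : WRel n 2) {m x₀ y₀} → δ (pair x₀ y₀) ≡ fin m →
                   (∀ x y → fin m ≤∞ δ (pair x y)) → minAll 2 δ ≡ fin m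
minAll₂-attained δ {x₀ = x₀} δ₀≡m m≤δ =
  minOver-attained _ (minOver-attained (λ y → δ (pair x₀ y)) δ₀≡m (m≤δ x₀))
                     (λ x → minOver-glb _ (m≤δ x))

Support : ∀ {n} → WRel n 2 → Rel (Fin n) 0ℓ
Support γ x y = IsFinite (γ (pair x y))

Realisable : ∀ {n} → Language n → Rel (Fin n) 0ℓ → Set
Realisable {n} Γ P = Σ (WRel n 2) λ β → 𝒞 Γ 2 β × Support β ⇔ P

module _ {n} {P Q R : Rel (Fin n) 0ℓ} where

  ⇔-trans : P ⇔ Q → Q ⇔ R → P ⇔ R
  ⇔-trans (P⇒Q , Q⇒P) (Q⇒R , R⇒Q) = (λ p → Q⇒R (P⇒Q p)) , (λ r → Q⇒P (R⇒Q r))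

realisable-⇔ : ∀ {n} {Γ : Language n} {P Q : Rel (Fin n) 0ℓ} → P ⇔ Q → Realisable Γ P → Realisable Γ Q
realisable-⇔ P⇔Q (β , β∈ , S) = β , β∈ , ⇔-trans S P⇔Q

support-eqRel : ∀ {n} → Support (eqRel {n}) ⇔ _≡_
support-eqRel = to , from
  where
  to : Support eqRel ⇒ _≡_
  to {x} {y} h with x ≟ y
  ... | yes x≡y = x≡y
  from : _≡_ ⇒ Support eqRel
  from {x} refl with x ≟ x
  ... | yes _   = tt
  ... | no x≢x = contradiction refl x≢x

realisable-≡ : ∀ {n} {Γ : Language n} → Realisable Γ _≡_
realisable-≡ = eqRel , equality , support-eqRel

module _ {n} (s₁ s₂ : Bool) (γ₁ γ₂ : WRel n 2) (x y : Fin n) where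

  private
    summand : Fin n → ℚ∞
    summand z = γ₁ (orient s₁ x z) +∞ γ₂ (orient s₂ y z)

  join-finite : ∀ z → IsFinite (γ₁ (orient s₁ x z)) → IsFinite (γ₂ (orient s₂ y z)) →
                IsFinite (join s₁ s₂ γ₁ γ₂ (pair x y))
  join-finite z h₁ h₂ = minOver-finite summand (+∞-finite h₁ h₂)

  join-finite⁻ : IsFinite (join s₁ s₂ γ₁ γ₂ (pair x y)) →
                 ∃[ z ] IsFinite (γ₁ (orient s₁ x z)) × IsFinite (γ₂ (orient s₂ y z))
  join-finite⁻ h = let z , h₁₂ = minOver-finite⁻ summand h in z , +∞-finite⁻ h₁₂

module _ {n} {Γ : Language n} {P Q : Rel (Fin n) 0ℓ} where

  realisable-; : Realisable Γ P → Realisable Γ Q → Realisable Γ (P ; Q)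
  realisable-; (β₁ , β₁∈ , P⇒ , ⇒P) (β₂ , β₂∈ , Q⇒ , ⇒Q) =
    join false true β₁ β₂ , joinC β₁∈ β₂∈ false true , to , from
    where
    to : Support (join false true β₁ β₂) ⇒ (P ; Q)
    to {x} {y} h = let z , h₁ , h₂ = join-finite⁻ false true β₁ β₂ x y h in z , P⇒ h₁ , Q⇒ h₂
    from : (P ; Q) ⇒ Support (join false true β₁ β₂)
    from {x} {y} (z , p , q) = join-finite false true β₁ β₂ x y z (⇒P p) (⇒Q q)

module _ {n} {Γ : Language n} {P : Rel (Fin n) 0ℓ} where

  realisable-flip : Realisable Γ P → Realisable Γ (flip P)
  realisable-flip (β , β∈ , P⇒ , ⇒P) = join true false β eqRel , joinC β∈ equality true false , to , from
    where
    to : Support (join true false β eqRel) ⇒ flip P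
    to {x} {y} h = let z , h₁ , h₂ = join-finite⁻ true false β eqRel x y h in
      subst (flip P x) (sym (proj₁ support-eqRel h₂)) (P⇒ h₁)
    from : flip P ⇒ Support (join true false β eqRel)
    from {x} {y} p = join-finite true false β eqRel x y y (⇒P p) (proj₂ support-eqRel refl)

module _ {n} (δ : WRel n 2) {m : ℚ} (min≡m : minAll 2 δ ≡ fin m) where

  private
    opt-finite⁻ : ∀ xy → IsFinite (Opt δ xy) → δ xy ≡ fin m
    opt-finite⁻ xy h with δ xy
    ... | fin q rewrite min≡m with q ℚ.≟ m
    ...   | yes refl = refl

    opt-finite : ∀ xy → δ xy ≡ fin m → IsFinite (Opt δ xy)
    opt-finite xy δ≡m with δ xy
    opt-finite xy refl | fin q rewrite min≡m with q ℚ.≟ q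
    ... | yes _  = tt
    ... | no q≢q = q≢q refl

  support-Opt : Support (Opt δ) ⇔ (λ x y → δ (pair x y) ≡ fin m)
  support-Opt = opt-finite⁻ _ , opt-finite _

Single : ∀ {n} → Fin n → Fin n → Rel (Fin n) 0ℓ
Single a b x y = x ≡ a × y ≡ b

Aligned : ∀ {n} → Vertex n → Vertex n → Rel (Fin n) 0ℓ
Aligned v w = Single (fst v) (fst w) ∪ Single (snd v) (snd w)

module _ {n} {u v w : Vertex n} where

  aligned-; : (Aligned u v ; Aligned v w) ⇔ Aligned u w
  aligned-; = compose , split
    where
    compose : (Aligned u v ; Aligned v w) ⇒ Aligned u w
    compose (_ , inj₁ (x≡ , refl) , inj₁ (_ , y≡))   = inj₁ (x≡ , y≡)
    compose (_ , inj₂ (x≡ , refl) , inj₂ (_ , y≡))   = inj₂ (x≡ , y≡)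
    compose (_ , inj₁ (_ , refl)  , inj₂ (a≡b , _))  = contradiction a≡b (distinct v)
    compose (_ , inj₂ (_ , refl)  , inj₁ (b≡a , _))  = contradiction (sym b≡a) (distinct v)
    split : Aligned u w ⇒ (Aligned u v ; Aligned v w)
    split (inj₁ (x≡ , y≡)) = fst v , inj₁ (x≡ , refl) , inj₁ (refl , y≡)
    split (inj₂ (x≡ , y≡)) = snd v , inj₂ (x≡ , refl) , inj₂ (refl , y≡)

module _ {n} {v w : Vertex n} where

  aligned-flipV : Aligned v w ⇔ Aligned (flipV v) (flipV w)
  aligned-flipV = swap , swap

  aligned-converse : flip (Aligned v w) ⇔ Aligned w v
  aligned-converse = ⊎-map ×-swap ×-swap , ⊎-map ×-swap ×-swap

realisable-aligned-; : ∀ {n} {Γ : Language n} u v w →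
  Realisable Γ (Aligned u v) → Realisable Γ (Aligned v w) → Realisable Γ (Aligned u w)
realisable-aligned-; u v w R S = realisable-⇔ (aligned-; {u = u} {v} {w}) (realisable-; R S)

twoPoint : ∀ {n} → Fin n → Fin n → ℚ → Fin n → ℚ∞
twoPoint a b t x with x ≟ a | x ≟ b
... | yes _ | _     = fin 0ℚ
... | no _  | yes _ = fin t
... | no _  | no _  = ∞

module _ {n} {a b : Fin n} {t : ℚ} where

  twoPoint-a : twoPoint a b t a ≡ fin 0ℚ
  twoPoint-a with a ≟ a
  ... | yes _   = refl
  ... | no a≢a = contradiction refl a≢a

  twoPoint-b : a ≢ b → twoPoint a b t b ≡ fin t
  twoPoint-b a≢b with b ≟ a | b ≟ b
  ... | yes b≡a | _       = contradiction (sym b≡a) a≢b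
  ... | no _    | yes _   = refl
  ... | no _    | no b≢b = contradiction refl b≢b

  twoPoint-finite⁻ : ∀ {x} → IsFinite (twoPoint a b t x) → x ≡ a ⊎ x ≡ b
  twoPoint-finite⁻ {x} h with x ≟ a | x ≟ b
  ... | yes x≡a | _       = inj₁ x≡a
  ... | no _    | yes x≡b = inj₂ x≡b

-- With γ₁₂ = q and γ₂₁ = r, the reweighted δ is ∞ off {a₁,b₁} × {a₂,b₂} and takes the values
-- γ₁₁, m, m and (γ₂₂ + m) + (m − (q + r)) on it; so given the two hypotheses of `realisable`,
-- m is its minimum and Opt δ is supported on the antidiagonal, plus (b₁,b₂) when γ₂₂ + m = q + r.
module Reweighting {n} {Γ : Language n} {γ : WRel n 2} (γ∈ : 𝒞 Γ 2 γ) (v w : Vertex n) {q r : ℚ}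
                   (γ₁₂≡q : γ (pair (fst v) (snd w)) ≡ fin q) (γ₂₁≡r : γ (pair (snd v) (fst w)) ≡ fin r)
                   (m : ℚ) where

  open Vertex v using () renaming (fst to a₁; snd to b₁; distinct to a₁≢b₁)
  open Vertex w using () renaming (fst to a₂; snd to b₂; distinct to a₂≢b₂)

  private
    open ≡-Reasoning

    μ : Fin n → ℚ∞
    μ = twoPoint a₁ b₁ (m - r)

    ν : Fin n → ℚ∞
    ν = twoPoint a₂ b₂ (m - q)

    δ : WRel n 2
    δ = addUnary (addUnary γ zero μ) (suc zero) ν

    δ-at : ∀ {x y s t} → μ x ≡ fin s → ν y ≡ fin t → δ (pair x y) ≡ (γ (pair x y) +∞ fin s) +∞ fin t
    δ-at {x} {y} = cong₂ (λ u u′ → (γ (pair x y) +∞ u) +∞ u′)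

    δ₁₁ : δ (pair a₁ a₂) ≡ γ (pair a₁ a₂)
    δ₁₁ = begin
      δ (pair a₁ a₂)                           ≡⟨ δ-at twoPoint-a twoPoint-a ⟩
      (γ (pair a₁ a₂) +∞ fin 0ℚ) +∞ fin 0ℚ     ≡⟨ +∞-identityʳ _ ⟩
      γ (pair a₁ a₂) +∞ fin 0ℚ                 ≡⟨ +∞-identityʳ _ ⟩
      γ (pair a₁ a₂)                           ∎

    δ₁₂ : δ (pair a₁ b₂) ≡ fin m
    δ₁₂ = begin
      δ (pair a₁ b₂)                            ≡⟨ δ-at twoPoint-a (twoPoint-b a₂≢b₂) ⟩
      (γ (pair a₁ b₂) +∞ fin 0ℚ) +∞ fin (m - q) ≡⟨ cong (_+∞ fin (m - q)) (+∞-identityʳ _) ⟩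
      γ (pair a₁ b₂) +∞ fin (m - q)             ≡⟨ cong (_+∞ fin (m - q)) γ₁₂≡q ⟩
      fin (q + (m - q))                         ≡⟨ cong fin (p+[q-p]≡q q m) ⟩
      fin m                                     ∎

    δ₂₁ : δ (pair b₁ a₂) ≡ fin m
    δ₂₁ = begin
      δ (pair b₁ a₂)                            ≡⟨ δ-at (twoPoint-b a₁≢b₁) twoPoint-a ⟩
      (γ (pair b₁ a₂) +∞ fin (m - r)) +∞ fin 0ℚ ≡⟨ +∞-identityʳ _ ⟩
      γ (pair b₁ a₂) +∞ fin (m - r)             ≡⟨ cong (_+∞ fin (m - r)) γ₂₁≡r ⟩
      fin (r + (m - r))                         ≡⟨ cong fin (p+[q-p]≡q r m) ⟩
      fin m                                     ∎

    δ₂₂ : δ (pair b₁ b₂) ≡ (γ (pair b₁ b₂) +∞ fin m) +∞ fin (m - (q + r))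
    δ₂₂ = trans (δ-at (twoPoint-b a₁≢b₁) (twoPoint-b a₂≢b₂)) (regroup (γ (pair b₁ b₂)))
      where
      regroup : ∀ x → (x +∞ fin (m - r)) +∞ fin (m - q) ≡ (x +∞ fin m) +∞ fin (m - (q + r))
      regroup (fin s) = cong fin
        (solve 4 (λ s m q r → (s :+ (m :- r)) :+ (m :- q) := (s :+ m) :+ (m :- (q :+ r))) refl s m q r)
      regroup ∞       = refl

    square-elim : {P : Rel (Fin n) 0ℓ} → P a₁ a₂ → P a₁ b₂ → P b₁ a₂ → P b₁ b₂ →
                  ∀ {x y} → IsFinite (δ (pair x y)) → P x y
    square-elim p₁₁ p₁₂ p₂₁ p₂₂ h
      with h-γμ , h-ν ← +∞-finite⁻ h
      with _ , h-μ ← +∞-finite⁻ h-γμ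
      with twoPoint-finite⁻ h-μ | twoPoint-finite⁻ h-ν
    ... | inj₁ refl | inj₁ refl = p₁₁
    ... | inj₁ refl | inj₂ refl = p₁₂
    ... | inj₂ refl | inj₁ refl = p₂₁
    ... | inj₂ refl | inj₂ refl = p₂₂

  TightCorners : Rel (Fin n) 0ℓ
  TightCorners = Aligned v (flipV w) ∪ λ x y → Single b₁ b₂ x y × γ (pair b₁ b₂) +∞ fin m ≡ fin (q + r)

  realisable : fin m <∞ γ (pair a₁ a₂) → fin (q + r) ≤∞ γ (pair b₁ b₂) +∞ fin m → Realisable Γ TightCorners
  realisable m<γ₁₁ q+r≤γ₂₂+m =
    Opt δ , opt (add (add γ∈ zero μ) (suc zero) ν) ,
    ⇔-trans (support-Opt δ (minAll₂-attained δ δ₁₂ m≤δ)) (tight⇒ , ⇒tight)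
    where
    d : ℚ
    d = m - (q + r)

    m≡q+r+d : fin m ≡ fin (q + r) +∞ fin d
    m≡q+r+d = cong fin (sym (p+[q-p]≡q (q + r) m))

    m≤δ : ∀ x y → fin m ≤∞ δ (pair x y)
    m≤δ x y = ≤∞-if-finite (square-elim {P = λ x y → fin m ≤∞ δ (pair x y)}
      (subst (fin m ≤∞_) (sym δ₁₁) (<∞⇒≤∞ m<γ₁₁))
      (subst (fin m ≤∞_) (sym δ₁₂) ℚ.≤-refl)
      (subst (fin m ≤∞_) (sym δ₂₁) ℚ.≤-refl)
      (subst₂ _≤∞_ (sym m≡q+r+d) (sym δ₂₂) (+∞-monoˡ-≤ d q+r≤γ₂₂+m)))

    tight⇒ : (λ x y → δ (pair x y) ≡ fin m) ⇒ TightCorners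
    tight⇒ δ≡m = square-elim {P = λ x y → δ (pair x y) ≡ fin m → TightCorners x y}
      (λ δ₁₁≡m → contradiction (trans (sym δ₁₁) δ₁₁≡m) (<∞⇒≢ m<γ₁₁))
      (λ _ → inj₁ (inj₁ (refl , refl)))
      (λ _ → inj₁ (inj₂ (refl , refl)))
      (λ δ₂₂≡m → inj₂ ((refl , refl) , +∞-cancelʳ d (trans (sym δ₂₂) (trans δ₂₂≡m m≡q+r+d))))
      (subst IsFinite (sym δ≡m) tt) δ≡m

    ⇒tight : TightCorners ⇒ (λ x y → δ (pair x y) ≡ fin m)
    ⇒tight (inj₁ (inj₁ (refl , refl)))    = δ₁₂
    ⇒tight (inj₁ (inj₂ (refl , refl)))    = δ₂₁
    ⇒tight (inj₂ ((refl , refl) , tight)) = trans δ₂₂ (trans (cong (_+∞ fin d) tight) (sym m≡q+r+d))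

edge-inequality : ∀ {n} {γ : WRel n 2} (v w : Vertex n) {q r} → EdgeWitness γ v w →
  γ (pair (fst v) (snd w)) ≡ fin q → γ (pair (snd v) (fst w)) ≡ fin r →
  fin (q + r) <∞ (γ (pair (fst v) (fst w)) +∞ γ (pair (snd v) (snd w)))
edge-inequality {γ = γ} v w (_ , _ , lt) γ₁₂≡q γ₂₁≡r =
  subst₂ (λ a b → (a +∞ b) <∞ (γ (pair (fst v) (fst w)) +∞ γ (pair (snd v) (snd w)))) γ₁₂≡q γ₂₁≡r lt

crossing-of-edgeCond : ∀ {n} {Γ : Language n} v w → EdgeCond Γ v w → Realisable Γ (Aligned v (flipV w))
crossing-of-edgeCond v w (γ , γ∈ , wit@(γ₁₂-finite , γ₂₁-finite , _)) =
  let q , γ₁₂≡q = finite⇒≡fin γ₁₂-finite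
      r , γ₂₁≡r = finite⇒≡fin γ₂₁-finite
      m , q+r<γ₂₂+m , m<γ₁₁ = between _ _ (edge-inequality {γ = γ} v w wit γ₁₂≡q γ₂₁≡r)
  in realisable-⇔ ([ id , (λ (_ , tight) → contradiction tight (<∞⇒≢ q+r<γ₂₂+m)) ]′ , inj₁)
                  (Reweighting.realisable γ∈ v w γ₁₂≡q γ₂₁≡r m m<γ₁₁ (<∞⇒≤∞ q+r<γ₂₂+m))

finite+finite<∞+ : ∀ {x y u} z → IsFinite x → IsFinite y → ¬ IsFinite u → (x +∞ y) <∞ (u +∞ z)
finite+finite<∞+ {fin _} {fin _} {∞}     _ _ _ _  = tt
finite+finite<∞+ {fin _} {fin _} {fin _} _ _ _ ¬u = ⊥-elim (¬u tt)

edgeWitness-of-support : ∀ {n} {β : WRel n 2} {P : Rel (Fin n) 0ℓ} (v w : Vertex n) → Support β ⇔ P →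
  P (fst v) (snd w) → P (snd v) (fst w) → ¬ P (fst v) (fst w) → EdgeWitness β v w
edgeWitness-of-support _ _ (P⇒ , ⇒P) p₁₂ p₂₁ ¬p₁₁ =
  ⇒P p₁₂ , ⇒P p₂₁ , finite+finite<∞+ _ (⇒P p₁₂) (⇒P p₂₁) (λ h → ¬p₁₁ (P⇒ h))

module _ {n} {Γ : Language n} where

  edgeCond-of-realisable : ∀ {P : Rel (Fin n) 0ℓ} (v w : Vertex n) → Realisable Γ P →
    P (fst v) (snd w) → P (snd v) (fst w) → ¬ P (fst v) (fst w) → EdgeCond Γ v w
  edgeCond-of-realisable v w (β , β∈ , S) p₁₂ p₂₁ ¬p₁₁ =
    β , β∈ , edgeWitness-of-support {β = β} v w S p₁₂ p₂₁ ¬p₁₁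

  edgeCond-of-crossing : ∀ v w → Realisable Γ (Aligned v (flipV w)) → EdgeCond Γ v w
  edgeCond-of-crossing v w R = edgeCond-of-realisable v w R (inj₁ (refl , refl)) (inj₂ (refl , refl)) λ where
    (inj₁ (_ , a₂≡b₂)) → distinct w a₂≡b₂
    (inj₂ (a₁≡b₁ , _)) → distinct v a₁≡b₁

  crossing-of-edge : ∀ v w → Edge Γ v w → Realisable Γ (Aligned v (flipV w))
  crossing-of-edge v w (inj₁ vw) = crossing-of-edgeCond v w vw
  crossing-of-edge v w (inj₂ wv) =
    realisable-⇔ (aligned-flipV {v = flipV v} {w})
      (realisable-⇔ (aligned-converse {v = w} {flipV v}) (realisable-flip (crossing-of-edgeCond w v wv)))

  edge-flipV : ∀ v → Edge Γ v (flipV v)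
  edge-flipV v = inj₁ (edgeCond-of-realisable v (flipV v) realisable-≡ refl refl (distinct v))

  selfLoop-of-edge-to-selfLoop : ∀ v w → Edge Γ v w → Edge Γ w w → Edge Γ v v
  selfLoop-of-edge-to-selfLoop v w vw ww = inj₁ (edgeCond-of-crossing v v
    (realisable-aligned-; v (flipV w) (flipV v) (crossing-of-edge v w vw)
      (realisable-aligned-; (flipV w) w (flipV v) w̄w (crossing-of-edge w v (swap vw)))))
    where
    w̄w : Realisable Γ (Aligned (flipV w) w)
    w̄w = realisable-⇔ (aligned-flipV {v = w} {flipV w}) (crossing-of-edge w w ww)

flipBy : ∀ {n} → Parity → Vertex n → Vertex n
flipBy 0ℙ v = v
flipBy 1ℙ v = flipV v

aligned-flipV-flipBy : ∀ {n} {u w : Vertex n} p → Aligned u (flipV (flipBy p w)) ⇔ Aligned u (flipBy (p ⁻¹) w)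
aligned-flipV-flipBy 0ℙ = id , id
aligned-flipV-flipBy 1ℙ = id , id

parity-suc : ∀ m → parity (suc m) ≡ parity m ⁻¹
parity-suc m = sym (⁻¹-selfInverse (suc-homo-⁻¹ m))

module _ {n} {Γ : Language n} where

  walk-crossing : ∀ m (c : Fin (suc m) → Vertex n) → (∀ i → Edge Γ (c (inject₁ i)) (c (suc i))) →
    Realisable Γ (Aligned (c zero) (flipBy (parity m) (c (fromℕ m))))
  walk-crossing zero    c _     = crossing-of-edge (c zero) (flipV (c zero)) (edge-flipV (c zero))
  walk-crossing (suc m) c edges =
    subst (λ p → Realisable Γ (Aligned (c zero) (flipBy p last))) (sym (parity-suc m))
      (realisable-⇔ (aligned-flipV-flipBy {u = c zero} {last} (parity m))
        (realisable-aligned-; (c zero) (flipV (c (suc zero))) (flipV (flipBy (parity m) last))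
          (crossing-of-edge (c zero) (c (suc zero)) (edges zero))
          (realisable-⇔ (aligned-flipV {v = c (suc zero)} {flipBy (parity m) last})
            (walk-crossing m (λ i → c (suc i)) (λ i → edges (suc i))))))
    where
    last : Vertex n
    last = c (fromℕ (suc m))

  selfLoop-of-oddClosedWalk : ∀ m (c : Fin (suc m) → Vertex n) → parity m ≡ 0ℙ →
    (∀ i → Edge Γ (c (inject₁ i)) (c (suc i))) → Edge Γ (c (fromℕ m)) (c zero) → Edge Γ (c zero) (c zero)
  selfLoop-of-oddClosedWalk m c even edges closing = inj₁ (edgeCond-of-crossing (c zero) (c zero)
    (realisable-aligned-; (c zero) (c (fromℕ m)) (flipV (c zero)) walk
      (crossing-of-edge (c (fromℕ m)) (c zero) closing)))
    where
    walk : Realisable Γ (Aligned (c zero) (c (fromℕ m)))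
    walk = subst (λ p → Realisable Γ (Aligned (c zero) (flipBy p (c (fromℕ m))))) even (walk-crossing m c edges)

-- Same gadget as for crossings, at the level m = q + r − s where (b₁,b₂) is optimal as well.
tripod-of-softCorner : ∀ {n} {Γ : Language n} {γ} v w → 𝒞 Γ 2 γ → EdgeWitness γ v w →
  IsFinite (γ (pair (snd v) (snd w))) → Realisable Γ (Aligned v (flipV w) ∪ Single (snd v) (snd w))
tripod-of-softCorner {γ = γ} v w γ∈ wit@(γ₁₂-finite , γ₂₁-finite , _) γ₂₂-finite =
  let q , γ₁₂≡q = finite⇒≡fin γ₁₂-finite
      r , γ₂₁≡r = finite⇒≡fin γ₂₁-finite
      s , γ₂₂≡s = finite⇒≡fin γ₂₂-finite
      m<γ₁₁ = p<∞x+q⇒p-q<∞x _ (subst (λ u → fin (q + r) <∞ (γ (pair (fst v) (fst w)) +∞ u)) γ₂₂≡s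
                                 (edge-inequality {γ = γ} v w wit γ₁₂≡q γ₂₁≡r))
      tight = trans (cong (_+∞ fin (q + r - s)) γ₂₂≡s) (cong fin (p+[q-p]≡q s (q + r)))
  in realisable-⇔ (⊎-map id proj₁ , ⊎-map id (_, tight))
                  (Reweighting.realisable γ∈ v w γ₁₂≡q γ₂₁≡r (q + r - s) m<γ₁₁
                     (subst (fin (q + r) ≤∞_) (sym tight) ℚ.≤-refl))

edgeWitness-flipV : ∀ {n} {γ : WRel n 2} (v w : Vertex n) → EdgeWitness γ v w → EdgeWitness γ (flipV v) (flipV w)
edgeWitness-flipV {γ = γ} v w (γ₁₂-finite , γ₂₁-finite , lt) =
  γ₂₁-finite , γ₁₂-finite , subst₂ _<∞_ (+∞-comm _ _) (+∞-comm (γ (pair (fst v) (fst w))) _) lt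

module _ {n} {Γ : Language n} where

  softSelfLoop-of-tripod : ∀ v w → Realisable Γ (Aligned w (flipV w)) →
    Realisable Γ (Aligned v (flipV w) ∪ Single (snd v) (snd w)) → SoftCond Γ v v
  softSelfLoop-of-tripod v w L T =
    let ρ , ρ∈ , S = realisable-; T (realisable-; L (realisable-flip T))
    in ρ , ρ∈ , edgeWitness-of-support {β = ρ} v v S a₁b₁ b₁a₁ ¬a₁a₁ , inj₂ (proj₂ S b₁b₁)
    where
    open Vertex v using () renaming (fst to a₁; snd to b₁)
    open Vertex w using () renaming (fst to a₂; snd to b₂)
    Tr : Rel (Fin n) 0ℓ
    Tr = Aligned v (flipV w) ∪ Single b₁ b₂
    -- a₁ ↦ b₂ ↦ a₂ ↦ b₁,  b₁ ↦ a₂ ↦ b₂ ↦ a₁,  b₁ ↦ a₂ ↦ b₂ ↦ b₁;  but a₁ only reaches a₂.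
    a₁b₁ : (Tr ; Aligned w (flipV w) ; flip Tr) a₁ b₁
    a₁b₁ = b₂ , inj₁ (inj₁ (refl , refl)) , a₂ , inj₂ (refl , refl) , inj₁ (inj₂ (refl , refl))
    b₁a₁ : (Tr ; Aligned w (flipV w) ; flip Tr) b₁ a₁
    b₁a₁ = a₂ , inj₁ (inj₂ (refl , refl)) , b₂ , inj₁ (refl , refl) , inj₁ (inj₁ (refl , refl))
    b₁b₁ : (Tr ; Aligned w (flipV w) ; flip Tr) b₁ b₁
    b₁b₁ = a₂ , inj₁ (inj₂ (refl , refl)) , b₂ , inj₁ (refl , refl) , inj₂ (refl , refl)
    ¬a₁a₁ : ¬ (Tr ; Aligned w (flipV w) ; flip Tr) a₁ a₁
    ¬a₁a₁ (_ , inj₁ (inj₂ (a₁≡b₁ , _)) , _) = distinct v a₁≡b₁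
    ¬a₁a₁ (_ , inj₂ (a₁≡b₁ , _) , _)        = distinct v a₁≡b₁
    ¬a₁a₁ (_ , inj₁ (inj₁ (_ , refl)) , _ , inj₁ (b₂≡a₂ , _) , _)                    = distinct w (sym b₂≡a₂)
    ¬a₁a₁ (_ , inj₁ (inj₁ (_ , refl)) , _ , inj₂ (_ , refl) , inj₁ (inj₁ (_ , a₂≡b₂))) = distinct w a₂≡b₂
    ¬a₁a₁ (_ , inj₁ (inj₁ (_ , refl)) , _ , inj₂ (_ , refl) , inj₁ (inj₂ (a₁≡b₁ , _))) = distinct v a₁≡b₁
    ¬a₁a₁ (_ , inj₁ (inj₁ (_ , refl)) , _ , inj₂ (_ , refl) , inj₂ (a₁≡b₁ , _))        = distinct v a₁≡b₁

  softSelfLoop-of-softCond : ∀ v w → Edge Γ w w → SoftCond Γ v w →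
    SoftCond Γ v v ⊎ SoftCond Γ (flipV v) (flipV v)
  softSelfLoop-of-softCond v w ww (γ , γ∈ , wit , inj₂ γ₂₂-finite) =
    inj₁ (softSelfLoop-of-tripod v w (crossing-of-edge w w ww) (tripod-of-softCorner v w γ∈ wit γ₂₂-finite))
  softSelfLoop-of-softCond v w ww (γ , γ∈ , wit , inj₁ γ₁₁-finite) =
    inj₂ (softSelfLoop-of-tripod (flipV v) (flipV w)
      (realisable-⇔ (aligned-flipV {v = w} {flipV w}) (crossing-of-edge w w ww))
      (tripod-of-softCorner (flipV v) (flipV w) γ∈ (edgeWitness-flipV {γ = γ} v w wit) γ₁₁-finite))

  no-softCond-into-selfLoop : (∀ v → ¬ SoftEdge Γ v v) → ∀ v w → Edge Γ w w → ¬ SoftCond Γ v w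
  no-softCond-into-selfLoop noSoftLoop v w ww vw with softSelfLoop-of-softCond v w ww vw
  ... | inj₁ vv = noSoftLoop v (inj₁ vv)
  ... | inj₂ v̄v̄ = noSoftLoop (flipV v) (inj₁ v̄v̄)

lemma4p9 : (n : ℕ) (Γ : Language n) → Conservative Γ →
    (∀ v → ¬ SoftEdge Γ v v) →
    ((∀ v → Edge Γ v (flipV v)) ×
     (∀ v w → InM Γ v → InMbar Γ w → ¬ Edge Γ v w) ×
     ¬ OddCycleInM Γ ×
     (∀ v w → InMbar Γ v → InMbar Γ w → ¬ SoftEdge Γ v w))
lemma4p9 n Γ _ noSoftLoop = edge-flipV , noEdge-M-M̄ , noOddCycle-M , noSoftEdge-M̄
  where
  noEdge-M-M̄ : ∀ v w → InM Γ v → InMbar Γ w → ¬ Edge Γ v w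
  noEdge-M-M̄ v w v∉M̄ w∈M̄ vw = v∉M̄ (selfLoop-of-edge-to-selfLoop v w vw w∈M̄)

  noOddCycle-M : ¬ OddCycleInM Γ
  noOddCycle-M (m , C , (j , m≡2j) , inM) =
    inM zero (selfLoop-of-oddClosedWalk m c (trans (cong parity m≡2j) (*-homo-* 2 j)) steps closing)
    where open Cycle C

  noSoftEdge-M̄ : ∀ v w → InMbar Γ v → InMbar Γ w → ¬ SoftEdge Γ v w
  noSoftEdge-M̄ v w _   w∈M̄ (inj₁ vw) = no-softCond-into-selfLoop noSoftLoop v w w∈M̄ vw
  noSoftEdge-M̄ v w v∈M̄ _   (inj₂ wv) = no-softCond-into-selfLoop noSoftLoop w v v∈M̄ wv
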